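{- For any connected graph $G$ of order $n\ge 2$, $\eta_p(G)\le \eta(G)+1$.
   Context: Graphs are finite, simple, undirected and connected. A set $S\subseteq V(G)$ is resolving if for every pair of distinct $v,w\in V(G)$ there is $x\in S$ with $d(v,x)\ne d(w,x)$; dominating if every vertex not in $S$ has a neighbor in $S$. The resolving domination number $\eta(G)$ is the minimum cardinality of a set that is both resolving and dominating. For $v\in V(G)$ and $S\subseteq V(G)$, $d(v,S)=\min\{d(v,w):w\in S\}$. For a partition $\Pi=\{S_1,\dots,S_k\}$ of $V(G)$, $r(u|\Pi)=(d(u,S_1),\dots,d(u,S_k))$; $\Pi$ is resolving if $r(u|\Pi)\ne r(v|\Pi)$ for all distinct $u,v$, and dominating if each vertex $v$ has $d(v,S_j)=1$ for some $j$. $\eta_p(G)$ is the minimum cardinality of a partition that is both resolving and dominating. -}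

module Defs where

open import Data.Nat using (ℕ; zero; suc; _≤_; _+_)
open import Data.Fin using (Fin)
open import Data.Fin.Subset using (Subset; _∈_; ∣_∣)
open import Data.Product using (Σ; ∃; ∃-syntax; _×_; _,_)
open import Relation.Nullary using (¬_)
open import Relation.Binary.PropositionalEquality using (_≡_; _≢_)
open import Function using (Surjective)
open import Level using (0ℓ)

record Graph (n : ℕ) : Set₁ where
  field
    Adj     : Fin n → Fin n → Set
    sym     : ∀ {u v} → Adj u v → Adj v u
    irrefl  : ∀ {u} → ¬ Adj u u

module _ {n : ℕ} (G : Graph n) where
  open Graph G

  data Walk : ℕ → Fin n → Fin n → Set where
    here : ∀ {u} → Walk zero u u
    step : ∀ {k u v w} → Adj u v → Walk k v w → Walk (suc k) u w

  Connected : Set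
  Connected = ∀ u v → ∃[ k ] Walk k u v

  Dist : Fin n → Fin n → ℕ → Set
  Dist u v k = Walk k u v × (∀ m → Walk m u v → k ≤ m)

  SetDist : Fin n → (Fin n → Set) → ℕ → Set
  SetDist v S k = (∃[ x ] (S x × Dist v x k))
                × (∀ x m → S x → Dist v x m → k ≤ m)

  Resolving : Subset n → Set
  Resolving S = ∀ v w → v ≢ w →
    ∃[ x ] (x ∈ S × ∃[ a ] ∃[ b ] (Dist v x a × Dist w x b × a ≢ b))

  Dominating : Subset n → Set
  Dominating S = ∀ v → ¬ (v ∈ S) → ∃[ x ] (x ∈ S × Adj v x)

  ResolvingDominatingSet : Subset n → Set
  ResolvingDominatingSet S = Resolving S × Dominating S

  -- A partition of V(G) into k (nonempty) classes S_1,…,S_k is given by a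
  -- surjective class map; class j is  S_j = { v | cls v ≡ j }.
  IsPartition : (k : ℕ) → (Fin n → Fin k) → Set
  IsPartition k cls = Surjective _≡_ _≡_ cls

  Class : {k : ℕ} → (Fin n → Fin k) → Fin k → Fin n → Set
  Class cls j v = cls v ≡ j

  -- Resolving partition: r(u|Π) ≠ r(v|Π) for distinct u, v, i.e. some
  -- coordinate d(·,S_j) differs.
  ResolvingPartition : {k : ℕ} → (Fin n → Fin k) → Set
  ResolvingPartition {k} cls = ∀ u v → u ≢ v →
    ∃[ j ] ∃[ a ] ∃[ b ]
      (SetDist u (Class cls j) a × SetDist v (Class cls j) b × a ≢ b)

  DominatingPartition : {k : ℕ} → (Fin n → Fin k) → Set
  DominatingPartition {k} cls = ∀ v → ∃[ j ] SetDist v (Class cls j) 1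

  ResolvingDominatingPartition : (k : ℕ) → (Fin n → Fin k) → Set
  ResolvingDominatingPartition k cls =
    IsPartition k cls × ResolvingPartition cls × DominatingPartition cls

  IsEta : ℕ → Set
  IsEta e = (∃[ S ] (ResolvingDominatingSet S × ∣ S ∣ ≡ e))
          × (∀ S → ResolvingDominatingSet S → e ≤ ∣ S ∣)

  IsEtaP : ℕ → Set
  IsEtaP p = (∃[ cls ] ResolvingDominatingPartition p cls)
           × (∀ k cls → ResolvingDominatingPartition k cls → p ≤ k)

module Submission where

-- Idea (following the paper): let S be a minimum resolving dominating set,
-- |S| = η(G).  Put every vertex of S into a class of its own and, if some
-- vertex lies outside S, collect all remaining vertices into one further
-- class.  This partition has at most |S| + 1 classes and is resolving and
-- dominating, so η_p(G) ≤ η(G) + 1.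

open import Defs
open import Data.Nat using (ℕ; suc; _≤_; _+_; s≤s; z≤n)
open import Data.Nat.Properties using (≤-trans; +-comm; m≤m+n)
open import Data.Bool using (true; false)
open import Data.Vec using (_∷_; here; there)
open import Data.Fin using (Fin) renaming (zero to fzero; suc to fsuc)
open import Data.Fin.Properties using (all?; ¬∀⟶∃¬; suc-injective)
open import Data.Fin.Subset using (Subset; _∈_; _∉_; ∣_∣)
open import Data.Fin.Subset.Properties using (_∈?_)
open import Data.Product using (Σ; ∃-syntax; _,_; proj₁; proj₂)
open import Data.Empty using (⊥-elim)
open import Relation.Nullary using (yes; no)
open import Relation.Binary.PropositionalEquality
  using (_≡_; _≢_; refl; sym; trans; cong; subst)

index : ∀ {n} (p : Subset n) {x : Fin n} → x ∈ p → Fin ∣ p ∣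
index (true ∷ p) here = fzero
index (true ∷ p) (there x∈p) = fsuc (index p x∈p)
index (false ∷ p) (there x∈p) = index p x∈p

-- Membership in a subset has at most one proof, so the index of a member
-- does not depend on how membership was established.
∈-irrelevant : ∀ {n} {p : Subset n} {x : Fin n} (q q′ : x ∈ p) → q ≡ q′
∈-irrelevant here here = refl
∈-irrelevant (there q) (there q′) = cong there (∈-irrelevant q q′)

index-injective : ∀ {n} (p : Subset n) {x y : Fin n} (x∈p : x ∈ p) (y∈p : y ∈ p) →
  index p x∈p ≡ index p y∈p → x ≡ y
index-injective (true ∷ p) here here eq = refl
index-injective (true ∷ p) here (there y∈p) ()
index-injective (true ∷ p) (there x∈p) here ()
index-injective (true ∷ p) (there x∈p) (there y∈p) eq =
  cong fsuc (index-injective p x∈p y∈p (suc-injective eq))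
index-injective (false ∷ p) (there x∈p) (there y∈p) eq =
  cong fsuc (index-injective p x∈p y∈p eq)

index-surjective : ∀ {n} (p : Subset n) (i : Fin ∣ p ∣) →
  ∃[ x ] Σ (x ∈ p) λ x∈p → index p x∈p ≡ i
index-surjective (true ∷ p) fzero = fzero , here , refl
index-surjective (true ∷ p) (fsuc i) with index-surjective p i
... | x , x∈p , eq = fsuc x , there x∈p , cong fsuc eq
index-surjective (false ∷ p) i with index-surjective p i
... | x , x∈p , eq = fsuc x , there x∈p , eq

module _ {n : ℕ} (G : Graph n) where
  open Graph G using (Adj; irrefl)

  -- Every vertex has a neighbour (needed to dominate the singleton classes).
  NoIsolatedVertex : Set
  NoIsolatedVertex = ∀ v → ∃[ x ] Adj v x

  walk-first-edge : ∀ {k v w} → Walk G k v w → v ≢ w → ∃[ x ] Adj v x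
  walk-first-edge here v≢w = ⊥-elim (v≢w refl)
  walk-first-edge (step a _) _ = _ , a

  walk-positive : ∀ {k v w} → Walk G k v w → v ≢ w → 1 ≤ k
  walk-positive here v≢w = ⊥-elim (v≢w refl)
  walk-positive (step _ _) _ = s≤s z≤n

  connected⇒noIsolated : 2 ≤ n → Connected G → NoIsolatedVertex
  connected⇒noIsolated (s≤s (s≤s _)) conn v =
    walk-first-edge (proj₂ (conn v (other v))) (other≢ v)
    where
    other : ∀ {m} → Fin (suc (suc m)) → Fin (suc (suc m))
    other fzero = fsuc fzero
    other (fsuc _) = fzero
    other≢ : ∀ {m} (u : Fin (suc (suc m))) → u ≢ other u
    other≢ fzero ()
    other≢ (fsuc _) ()

  module _ {k : ℕ} (cls : Fin n → Fin k) where

    AloneInClass : Fin n → Set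
    AloneInClass x = ∀ {y} → cls y ≡ cls x → y ≡ x

    singleton-setDist : ∀ {v x c} → AloneInClass x → Dist G v x c →
      SetDist G v (Class G cls (cls x)) c
    singleton-setDist {v} {x} {c} alone d = (x , refl , d) , shortest
      where
      shortest : ∀ y m → cls y ≡ cls x → Dist G v y m → c ≤ m
      shortest y m eq dy with alone eq
      ... | refl = proj₂ d m (proj₁ dy)

    neighbour-setDist : ∀ {v x} → cls v ≢ cls x → Adj v x →
      SetDist G v (Class G cls (cls x)) 1
    neighbour-setDist {v} {x} differ a = (x , refl , step a here , atLeastOne) , shortest
      where
      shortest : ∀ y m → cls y ≡ cls x → Dist G v y m → 1 ≤ m
      shortest y m eq dy = walk-positive (proj₁ dy) λ { refl → differ eq }
      atLeastOne : ∀ m → Walk G m v x → 1 ≤ m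
      atLeastOne m w = walk-positive w λ { refl → differ refl }

    -- Key lemma: if every member of a resolving dominating set S is alone
    -- in its class, the partition is resolving (S resolves, and a singleton
    -- class {x} measures d(·,x)) and dominating (a neighbour of v that is
    -- in S, or any neighbour when v ∈ S, lies in a class other than v's).
    separating⇒resolvingDominating : NoIsolatedVertex →
      (S : Subset n) → ResolvingDominatingSet G S →
      IsPartition G k cls → (∀ {x} → x ∈ S → AloneInClass x) →
      ResolvingDominatingPartition G k cls
    separating⇒resolvingDominating noIso S (resolving , dominating) partition alone =
      partition , resolvingPartition , dominatingPartition
      where
      resolvingPartition : ResolvingPartition G cls
      resolvingPartition u v u≢v with resolving u v u≢v
      ... | x , x∈S , a , b , du , dv , a≢b =
        cls x , a , b , singleton-setDist (alone x∈S) du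
                      , singleton-setDist (alone x∈S) dv , a≢b
      dominatingPartition : DominatingPartition G cls
      dominatingPartition v with v ∈? S
      ... | yes v∈S =
        let (x , a) = noIso v
        in cls x , neighbour-setDist
                     (λ eq → irrefl (subst (Adj v) (alone v∈S (sym eq)) a)) a
      ... | no v∉S =
        let (x , x∈S , a) = dominating v v∉S
        in cls x , neighbour-setDist
                     (λ eq → v∉S (subst (_∈ S) (sym (alone x∈S eq)) x∈S)) a

  module _ (S : Subset n) where

    memberClass : (∀ v → v ∈ S) → Fin n → Fin ∣ S ∣
    memberClass all∈S v = index S (all∈S v)

    memberClass-partition : (all∈S : ∀ v → v ∈ S) → IsPartition G ∣ S ∣ (memberClass all∈S)
    memberClass-partition all∈S i with index-surjective S i
    ... | x , x∈S , eq = x , λ { refl → subst (λ q → index S q ≡ i) (∈-irrelevant x∈S (all∈S x)) eq }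

    memberClass-alone : (all∈S : ∀ v → v ∈ S) →
      ∀ {x} → x ∈ S → AloneInClass (memberClass all∈S) x
    memberClass-alone all∈S {x} _ eq = index-injective S (all∈S _) (all∈S x) eq

    extendedClass : Fin n → Fin (suc ∣ S ∣)
    extendedClass v with v ∈? S
    ... | yes v∈S = fsuc (index S v∈S)
    ... | no _ = fzero

    extendedClass-∈ : ∀ {v} (v∈S : v ∈ S) → extendedClass v ≡ fsuc (index S v∈S)
    extendedClass-∈ {v} v∈S with v ∈? S
    ... | yes v∈S′ = cong (λ q → fsuc (index S q)) (∈-irrelevant v∈S′ v∈S)
    ... | no v∉S = ⊥-elim (v∉S v∈S)

    extendedClass-∉ : ∀ {v} → v ∉ S → extendedClass v ≡ fzero
    extendedClass-∉ {v} v∉S with v ∈? S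
    ... | yes v∈S = ⊥-elim (v∉S v∈S)
    ... | no _ = refl

    extendedClass-partition : ∀ {z} → z ∉ S → IsPartition G (suc ∣ S ∣) extendedClass
    extendedClass-partition {z} z∉S fzero = z , λ { refl → extendedClass-∉ z∉S }
    extendedClass-partition z∉S (fsuc i) with index-surjective S i
    ... | x , x∈S , refl = x , λ { refl → extendedClass-∈ x∈S }

    -- A member of S shares its class with no other vertex: other members have
    -- other indices, and non-members are in class 0.
    extendedClass-alone : ∀ {x} → x ∈ S → AloneInClass extendedClass x
    extendedClass-alone {x} x∈S {y} eq with y ∈? S
    ... | yes y∈S = index-injective S y∈S x∈S (suc-injective (trans eq (extendedClass-∈ x∈S)))
    ... | no _ with trans eq (extendedClass-∈ x∈S)
    ... | ()

mainTheorem10 : (n : ℕ) → 2 ≤ n → (G : Graph n) → Connected G →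
    (e p : ℕ) → IsEta G e → IsEtaP G p → p ≤ e + 1
mainTheorem10 n 2≤n G conn e p ((S , rds , refl) , _) (_ , minimal)
  with connected⇒noIsolated G 2≤n conn | all? (_∈? S)
... | noIsolated | yes all∈S =
  ≤-trans (minimal ∣ S ∣ (memberClass G S all∈S)
             (separating⇒resolvingDominating G _ noIsolated S rds
                (memberClass-partition G S all∈S) (memberClass-alone G S all∈S)))
          (m≤m+n ∣ S ∣ 1)
... | noIsolated | no notAll =
  let (z , z∉S) = ¬∀⟶∃¬ n (_∈ S) (_∈? S) notAll
  in subst (p ≤_) (+-comm 1 ∣ S ∣)
       (minimal (suc ∣ S ∣) (extendedClass G S)
          (separating⇒resolvingDominating G _ noIsolated S rds
             (extendedClass-partition G S z∉S) (extendedClass-alone G S)))
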